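{- If a nontrivial graph $G$ (i.e. $|V(G)|\ge 2$) belongs to $\mathcal{S}_3$, then $|E(G)|\ge 3|V(G)|-2$.
   Context: Graphs may have parallel edges but no loops. $Z(G,\mathbb{Z}_3)$ is the set of $\beta:V(G)\to\mathbb{Z}_3$ with $\sum_v\beta(v)\equiv0\pmod 3$; a $\beta$-orientation is an orientation $D$ with $d^+_D(v)-d^-_D(v)\equiv\beta(v)\pmod 3$ for all $v$; $\mathcal{S}_3$ is the family of graphs admitting a strongly-connected $\beta$-orientation for every $\beta\in Z(G,\mathbb{Z}_3)$. -}

module Defs where

open import Data.Nat using (ℕ; zero; suc; _+_; _%_)
open import Data.Fin using (Fin; zero; suc; toℕ)
open import Data.Bool using (Bool; true; false; if_then_else_)
open import Data.Product using (_×_; _,_; proj₁; proj₂; ∃-syntax)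
open import Data.Integer as ℤ using (ℤ; +_)
open import Data.Integer.DivMod using (_%ℕ_)
open import Relation.Binary.PropositionalEquality using (_≡_; _≢_)
open import Relation.Nullary using (does)
open import Data.Fin using (_≟_)

-- A (multi)graph with vertex set Fin n and edge set Fin m.
-- Each edge has two endpoints; parallel edges allowed, loops forbidden.
record Graph : Set where
  field
    n     : ℕ
    m     : ℕ
    ends  : Fin m → Fin n × Fin n
    loopless : (e : Fin m) → proj₁ (ends e) ≢ proj₂ (ends e)
open Graph public

Σ-fin : (k : ℕ) → (Fin k → ℕ) → ℕ
Σ-fin zero    f = 0
Σ-fin (suc k) f = f zero + Σ-fin k (λ i → f (suc i))

-- An orientation chooses, for each edge, a direction:
-- true  : proj₁ (ends e) → proj₂ (ends e)
-- false : proj₂ (ends e) → proj₁ (ends e)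
Orientation : Graph → Set
Orientation G = Fin (m G) → Bool

tail head : (G : Graph) → Orientation G → Fin (m G) → Fin (n G)
tail G D e = if D e then proj₁ (ends G e) else proj₂ (ends G e)
head G D e = if D e then proj₂ (ends G e) else proj₁ (ends G e)

indicator : Bool → ℕ
indicator true  = 1
indicator false = 0

outdeg indeg : (G : Graph) → Orientation G → Fin (n G) → ℕ
outdeg G D v = Σ-fin (m G) (λ e → indicator (does (tail G D e ≟ v)))
indeg  G D v = Σ-fin (m G) (λ e → indicator (does (head G D e ≟ v)))

InZ3 : (G : Graph) → (Fin (n G) → Fin 3) → Set
InZ3 G β = Σ-fin (n G) (λ v → toℕ (β v)) % 3 ≡ 0

IsβOrientation : (G : Graph) → (Fin (n G) → Fin 3) → Orientation G → Set
IsβOrientation G β D =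
  (v : Fin (n G)) → ((+ outdeg G D v) ℤ.- (+ indeg G D v)) %ℕ 3 ≡ toℕ (β v)

data Reach (G : Graph) (D : Orientation G) : Fin (n G) → Fin (n G) → Set where
  here : ∀ {u} → Reach G D u u
  step : ∀ {v} (e : Fin (m G)) → Reach G D (head G D e) v → Reach G D (tail G D e) v

StronglyConnected : (G : Graph) → Orientation G → Set
StronglyConnected G D = (u v : Fin (n G)) → Reach G D u v

InS3 : Graph → Set
InS3 G = (β : Fin (n G) → Fin 3) → InZ3 G β →
  ∃[ D ] (IsβOrientation G β D × StronglyConnected G D)

-- Fix the root vertex 0 and choose the boundary β(v) ≡ 2·deg(v) (mod 3) for
-- every vertex v ≠ 0, and β(0) ≡ 2·(deg(0) + |E|), so that Σ β ≡ 2·(2|E| + |E|) ≡ 0.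
-- In a β-orientation every non-root vertex v satisfies
--   d⁺(v) − d⁻(v) ≡ 2·(d⁺(v) + d⁻(v)),   i.e.   d⁺(v) + 3·d⁻(v) ≡ 0   (mod 3),
-- so 3 ∣ d⁺(v).  Strong connectivity gives every vertex an out-going edge, hence
-- d⁺(v) ≥ 3 for v ≠ 0 and d⁺(0) ≥ 1.  Summing out-degrees counts each edge once:
--   |E| = Σ d⁺(v) ≥ 1 + 3·(|V| − 1) = 3|V| − 2.
module Submission where

open import Defs
open import Data.Nat using (_≤_; _*_; _∸_)
open import Data.Nat using (ℕ; zero; suc; _+_; _%_; NonZero; z≤n; s≤s; >-nonZero)
import Data.Nat.Properties as ℕ
open import Data.Nat.DivMod using (m%n%n≡m%n; m*n%n≡0; %-distribˡ-+; m%n<n)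
open import Data.Nat.Divisibility using (∣⇒≤) renaming (_∣_ to _∣ℕ_)
open import Data.Nat.Tactic.RingSolver as ℕ-Ring using ()
open import Algebra.Properties.CommutativeSemigroup ℕ.+-commutativeSemigroup
  using () renaming (interchange to +-interchange)
open import Data.Fin using (Fin; zero; suc; toℕ; fromℕ<; _≟_)
open import Data.Fin.Properties using (toℕ-fromℕ<)
open import Data.Bool using (true; false)
open import Data.Product using (_×_; proj₁; proj₂; ∃-syntax)
open import Data.Integer as ℤ using (ℤ; +_)
open import Data.Integer.DivMod using (_%ℕ_; _/ℕ_; a≡a%ℕn+[a/ℕn]*n)
import Data.Integer.Properties as ℤ
open import Data.Integer.Divisibility.Signed
  using (divides; ∣⇒∣ᵤ; ∣m∣n⇒∣m+n; ∣m∣n⇒∣m-n; ∣m⇒∣-m; ∣n⇒∣m*n; ∣-refl)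
  renaming (_∣_ to _∣ℤ_)
open import Data.Integer.Tactic.RingSolver as ℤ-Ring using ()
open import Data.Empty using (⊥-elim)
open import Relation.Binary.PropositionalEquality
open import Relation.Nullary using (does; yes; no)

[_≐_] : ∀ {k} → Fin k → Fin k → ℕ
[ x ≐ y ] = indicator (does (x ≟ y))

Σ-cong : ∀ k {f g : Fin k → ℕ} → (∀ i → f i ≡ g i) → Σ-fin k f ≡ Σ-fin k g
Σ-cong zero    f≗g = refl
Σ-cong (suc k) f≗g = cong₂ _+_ (f≗g zero) (Σ-cong k (λ i → f≗g (suc i)))

Σ-const : ∀ k c → Σ-fin k (λ _ → c) ≡ k * c
Σ-const zero    c = refl
Σ-const (suc k) c = cong (_+_ c) (Σ-const k c)

Σ-zero : ∀ k → Σ-fin k (λ _ → 0) ≡ 0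
Σ-zero k = trans (Σ-const k 0) (ℕ.*-zeroʳ k)

Σ-+ : ∀ k (f g : Fin k → ℕ) →
      Σ-fin k (λ i → f i + g i) ≡ Σ-fin k f + Σ-fin k g
Σ-+ zero    f g = refl
Σ-+ (suc k) f g = begin
  f zero + g zero + Σ-fin k (λ i → f (suc i) + g (suc i))
    ≡⟨ cong (_+_ (f zero + g zero)) (Σ-+ k (λ i → f (suc i)) (λ i → g (suc i))) ⟩
  f zero + g zero + (Σ-fin k (λ i → f (suc i)) + Σ-fin k (λ i → g (suc i)))
    ≡⟨ +-interchange (f zero) (g zero) _ _ ⟩
  f zero + Σ-fin k (λ i → f (suc i)) + (g zero + Σ-fin k (λ i → g (suc i))) ∎
  where open ≡-Reasoning

Σ-*ˡ : ∀ k c (f : Fin k → ℕ) → Σ-fin k (λ i → c * f i) ≡ c * Σ-fin k f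
Σ-*ˡ zero    c f = sym (ℕ.*-zeroʳ c)
Σ-*ˡ (suc k) c f = trans (cong (_+_ (c * f zero)) (Σ-*ˡ k c (λ i → f (suc i))))
                         (sym (ℕ.*-distribˡ-+ c (f zero) _))

Σ-swap : ∀ a b (f : Fin a → Fin b → ℕ) →
         Σ-fin a (λ i → Σ-fin b (f i)) ≡ Σ-fin b (λ j → Σ-fin a (λ i → f i j))
Σ-swap zero    b f = sym (Σ-zero b)
Σ-swap (suc a) b f =
  trans (cong (_+_ (Σ-fin b (f zero))) (Σ-swap a b (λ i → f (suc i))))
        (sym (Σ-+ b (f zero) (λ j → Σ-fin a (λ i → f (suc i) j))))

Σ-indicator : ∀ k (u : Fin k) → Σ-fin k (λ v → [ u ≐ v ]) ≡ 1
Σ-indicator (suc k) zero    = cong suc (Σ-zero k)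
Σ-indicator (suc k) (suc u) = Σ-indicator k u

Σ-fibres : ∀ a b (h : Fin a → Fin b) →
           Σ-fin b (λ v → Σ-fin a (λ e → [ h e ≐ v ])) ≡ a
Σ-fibres a b h = begin
  Σ-fin b (λ v → Σ-fin a (λ e → [ h e ≐ v ])) ≡⟨ Σ-swap a b (λ e v → [ h e ≐ v ]) ⟨
  Σ-fin a (λ e → Σ-fin b (λ v → [ h e ≐ v ])) ≡⟨ Σ-cong a (λ e → Σ-indicator b (h e)) ⟩
  Σ-fin a (λ _ → 1)                           ≡⟨ Σ-const a 1 ⟩
  a * 1                                       ≡⟨ ℕ.*-identityʳ a ⟩
  a                                           ∎
  where open ≡-Reasoning

term≤Σ : ∀ k (f : Fin k → ℕ) i → f i ≤ Σ-fin k f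
term≤Σ (suc k) f zero    = ℕ.m≤m+n (f zero) _
term≤Σ (suc k) f (suc i) = ℕ.≤-trans (term≤Σ k (λ j → f (suc j)) i) (ℕ.m≤n+m _ (f zero))

Σ-mono : ∀ k {f g : Fin k → ℕ} → (∀ i → f i ≤ g i) → Σ-fin k f ≤ Σ-fin k g
Σ-mono zero    f≤g = z≤n
Σ-mono (suc k) f≤g = ℕ.+-mono-≤ (f≤g zero) (Σ-mono k (λ i → f≤g (suc i)))

Σ-% : ∀ k d .{{_ : NonZero d}} (f : Fin k → ℕ) →
      Σ-fin k (λ i → f i % d) % d ≡ Σ-fin k f % d
Σ-% zero    d f = refl
Σ-% (suc k) d f = begin
  (f zero % d + S%) % d           ≡⟨ %-distribˡ-+ (f zero % d) S% d ⟩
  (f zero % d % d + S% % d) % d   ≡⟨ cong₂ (λ x y → (x + y) % d)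
                                           (m%n%n≡m%n (f zero) d) (Σ-% k d (λ i → f (suc i))) ⟩
  (f zero % d + S % d) % d        ≡⟨ %-distribˡ-+ (f zero) S d ⟨
  (f zero + S) % d                ∎
  where
  open ≡-Reasoning
  S% = Σ-fin k (λ i → f (suc i) % d)
  S  = Σ-fin k (λ i → f (suc i))

module _ (G : Graph) where

  deg : Fin (n G) → ℕ
  deg v = Σ-fin (m G) (λ e → [ proj₁ (ends G e) ≐ v ] + [ proj₂ (ends G e) ≐ v ])

  -- Reversing an edge swaps its tail and head, so d⁺ + d⁻ is the degree.
  out+in≡deg : ∀ D v → outdeg G D v + indeg G D v ≡ deg v
  out+in≡deg D v = trans (sym (Σ-+ (m G) _ _)) (Σ-cong (m G) ends-at-v)
    where
    ends-at-v : ∀ e → [ tail G D e ≐ v ] + [ head G D e ≐ v ]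
                    ≡ [ proj₁ (ends G e) ≐ v ] + [ proj₂ (ends G e) ≐ v ]
    ends-at-v e with D e
    ... | true  = refl
    ... | false = ℕ.+-comm [ proj₂ (ends G e) ≐ v ] [ proj₁ (ends G e) ≐ v ]

  -- Handshake lemmas: every edge has one tail, and two ends.
  Σ-outdeg : ∀ D → Σ-fin (n G) (outdeg G D) ≡ m G
  Σ-outdeg D = Σ-fibres (m G) (n G) (tail G D)

  Σ-deg : Σ-fin (n G) deg ≡ m G + m G
  Σ-deg = trans (Σ-cong (n G) (λ v → Σ-+ (m G) _ _)) (trans (Σ-+ (n G) _ _)
                (cong₂ _+_ (Σ-fibres (m G) (n G) (λ e → proj₁ (ends G e)))
                           (Σ-fibres (m G) (n G) (λ e → proj₂ (ends G e)))))

  reach⇒outdeg≥1 : ∀ D {u v} → Reach G D u v → u ≢ v → 1 ≤ outdeg G D u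
  reach⇒outdeg≥1 D here         u≢u = ⊥-elim (u≢u refl)
  reach⇒outdeg≥1 D (step e _)   _   =
    ℕ.≤-trans (self≥1 (tail G D e)) (term≤Σ (m G) (λ e′ → [ tail G D e′ ≐ tail G D e ]) e)
    where
    self≥1 : ∀ x → 1 ≤ [ x ≐ x ]
    self≥1 x with x ≟ x
    ... | yes _   = s≤s z≤n
    ... | no x≢x  = ⊥-elim (x≢x refl)

residue-congruent : ∀ x d .{{_ : NonZero d}} → + d ∣ℤ x ℤ.- + (x %ℕ d)
residue-congruent x d = divides (x /ℕ d) (begin
  x ℤ.- + (x %ℕ d)                                     ≡⟨ cong (ℤ._- + (x %ℕ d)) (a≡a%ℕn+[a/ℕn]*n x d) ⟩
  (+ (x %ℕ d) ℤ.+ x /ℕ d ℤ.* + d) ℤ.- + (x %ℕ d)       ≡⟨ cancel (+ (x %ℕ d)) (x /ℕ d ℤ.* + d) ⟩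
  x /ℕ d ℤ.* + d                                       ∎)
  where
  open ≡-Reasoning
  cancel : ∀ r t → (r ℤ.+ t) ℤ.- r ≡ t
  cancel = ℤ-Ring.solve-∀

same-residue⇒∣ : ∀ x y d .{{_ : NonZero d}} → x %ℕ d ≡ y %ℕ d → + d ∣ℤ x ℤ.- y
same-residue⇒∣ x y d x≡y =
  subst (+ d ∣ℤ_) (difference x y (+ (x %ℕ d)))
    (subst (λ s → + d ∣ℤ (x ℤ.- + (x %ℕ d)) ℤ.- (y ℤ.- + s)) (sym x≡y)
      (∣m∣n⇒∣m-n (residue-congruent x d) (residue-congruent y d)))
  where
  difference : ∀ p q r → (p ℤ.- r) ℤ.- (q ℤ.- r) ≡ p ℤ.- q
  difference = ℤ-Ring.solve-∀

-- If a − b ≡ 2(a + b) (mod 3) then 3 ∣ a, because (a − b) − 2(a + b) + 3b = −a.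
-- With a = d⁺(v), b = d⁻(v) this is the β-orientation condition for β(v) ≡ 2·deg(v).
3∣outdeg : ∀ a b → (+ a ℤ.- + b) %ℕ 3 ≡ (2 * (a + b)) % 3 → 3 ∣ℕ a
3∣outdeg a b congruent = ∣⇒∣ᵤ (subst (+ 3 ∣ℤ_) (ℤ.neg-involutive (+ a)) (∣m⇒∣-m 3∣-a))
  where
  identity : ∀ (p q : ℤ) → ((p ℤ.- q) ℤ.- + 2 ℤ.* (p ℤ.+ q)) ℤ.+ q ℤ.* + 3 ≡ ℤ.- p
  identity = ℤ-Ring.solve-∀
  2deg : + (2 * (a + b)) ≡ + 2 ℤ.* (+ a ℤ.+ + b)
  2deg = trans (ℤ.pos-* 2 (a + b)) (cong (+ 2 ℤ.*_) (ℤ.pos-+ a b))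
  3∣-a : + 3 ∣ℤ ℤ.- + a
  3∣-a = subst (+ 3 ∣ℤ_) (trans (cong (λ N → ((+ a ℤ.- + b) ℤ.- N) ℤ.+ + b ℤ.* + 3) 2deg)
                                (identity (+ a) (+ b)))
               (∣m∣n⇒∣m+n (same-residue⇒∣ (+ a ℤ.- + b) (+ (2 * (a + b))) 3 congruent)
                          (∣n⇒∣m*n (+ b) ∣-refl))

indicator-≢ : ∀ {k} {u v : Fin k} → u ≢ v → [ u ≐ v ] ≡ 0
indicator-≢ {u = u} {v} u≢v with u ≟ v
... | yes u≡v = ⊥-elim (u≢v u≡v)
... | no _    = refl

module Rooted (G : Graph) (r : Fin (n G)) where

  target : Fin (n G) → ℕ
  target v = 2 * (deg G v + m G * [ r ≐ v ])

  β : Fin (n G) → Fin 3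
  β v = fromℕ< (m%n<n (target v) 3)

  -- Σ β ≡ 2·(2|E| + |E|) = 6|E| ≡ 0 (mod 3).
  β∈Z3 : InZ3 G β
  β∈Z3 = begin
    Σ-fin (n G) (λ v → toℕ (β v)) % 3
      ≡⟨ cong (_% 3) (Σ-cong (n G) (λ v → toℕ-fromℕ< (m%n<n (target v) 3))) ⟩
    Σ-fin (n G) (λ v → target v % 3) % 3
      ≡⟨ Σ-% (n G) 3 target ⟩
    Σ-fin (n G) target % 3
      ≡⟨ cong (_% 3) (Σ-*ˡ (n G) 2 (λ v → deg G v + m G * [ r ≐ v ])) ⟩
    2 * Σ-fin (n G) (λ v → deg G v + m G * [ r ≐ v ]) % 3
      ≡⟨ cong (λ s → 2 * s % 3) (Σ-+ (n G) (deg G) (λ v → m G * [ r ≐ v ])) ⟩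
    2 * (Σ-fin (n G) (deg G) + Σ-fin (n G) (λ v → m G * [ r ≐ v ])) % 3
      ≡⟨ cong₂ (λ s t → 2 * (s + t) % 3) (Σ-deg G)
               (trans (Σ-*ˡ (n G) (m G) (λ v → [ r ≐ v ])) (cong (m G *_) (Σ-indicator (n G) r))) ⟩
    2 * (m G + m G + m G * 1) % 3
      ≡⟨ cong (_% 3) (six-times (m G)) ⟩
    m G * 2 * 3 % 3
      ≡⟨ m*n%n≡0 (m G * 2) 3 ⟩
    0 ∎
    where
    open ≡-Reasoning
    six-times : ∀ e → 2 * (e + e + e * 1) ≡ e * 2 * 3
    six-times = ℕ-Ring.solve-∀

  nonroot⇒3∣outdeg : ∀ D → IsβOrientation G β D → ∀ v → r ≢ v → 3 ∣ℕ outdeg G D v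
  nonroot⇒3∣outdeg D β-orient v r≢v =
    3∣outdeg (outdeg G D v) (indeg G D v) (trans (β-orient v) (begin
      toℕ (β v)                                 ≡⟨ toℕ-fromℕ< (m%n<n (target v) 3) ⟩
      2 * (deg G v + m G * [ r ≐ v ]) % 3        ≡⟨ cong (λ s → 2 * s % 3) deg-at-v ⟩
      2 * (outdeg G D v + indeg G D v) % 3       ∎))
    where
    open ≡-Reasoning
    deg-at-v : deg G v + m G * [ r ≐ v ] ≡ outdeg G D v + indeg G D v
    deg-at-v = begin
      deg G v + m G * [ r ≐ v ]   ≡⟨ cong (λ i → deg G v + m G * i) (indicator-≢ r≢v) ⟩
      deg G v + m G * 0           ≡⟨ cong (_+_ (deg G v)) (ℕ.*-zeroʳ (m G)) ⟩
      deg G v + 0                 ≡⟨ ℕ.+-identityʳ (deg G v) ⟩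
      deg G v                     ≡⟨ out+in≡deg G D v ⟨
      outdeg G D v + indeg G D v  ∎

Σ-lower-bound : ∀ k (f : Fin (suc k) → ℕ) → 1 ≤ f zero → (∀ i → 3 ≤ f (suc i)) →
                1 + k * 3 ≤ Σ-fin (suc k) f
Σ-lower-bound k f f₀≥1 fₛ≥3 =
  ℕ.+-mono-≤ f₀≥1 (subst (_≤ Σ-fin k (λ i → f (suc i))) (Σ-const k 3) (Σ-mono k fₛ≥3))

-- 3·n − 2 for n = k + 2, in the shape produced by Σ-lower-bound.
3n∸2 : ∀ k → 3 * suc (suc k) ∸ 2 ≡ 1 + suc k * 3
3n∸2 k = trans (cong (_∸ 2) (expand k)) (ℕ.m+n∸n≡m (1 + suc k * 3) 2)
  where
  expand : ∀ k → 3 * suc (suc k) ≡ 1 + suc k * 3 + 2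
  expand = ℕ-Ring.solve-∀

lemma2p10 : (G : Graph) → 2 ≤ n G → InS3 G → 3 * n G ∸ 2 ≤ m G
lemma2p10 (record { n = zero })        ()
lemma2p10 (record { n = suc zero })    (s≤s ())
lemma2p10 G@(record { n = suc (suc k) }) _ G∈S₃ = begin
  3 * suc (suc k) ∸ 2               ≡⟨ 3n∸2 k ⟩
  1 + suc k * 3                     ≤⟨ Σ-lower-bound (suc k) (outdeg G D) root≥1 nonroot≥3 ⟩
  Σ-fin (suc (suc k)) (outdeg G D)  ≡⟨ Σ-outdeg G D ⟩
  m G                               ∎
  where
  open ℕ.≤-Reasoning
  open Rooted G zero
  oriented : ∃[ D ] (IsβOrientation G β D × StronglyConnected G D)
  oriented = G∈S₃ β β∈Z3

  D : Orientation G
  D = proj₁ oriented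

  strong : StronglyConnected G D
  strong = proj₂ (proj₂ oriented)

  -- Strong connectivity: every vertex reaches a different vertex, so has an out-edge;
  -- away from the root the out-degree is moreover a multiple of 3.
  root≥1 : 1 ≤ outdeg G D zero
  root≥1 = reach⇒outdeg≥1 G D (strong zero (suc zero)) (λ ())

  nonroot≥3 : ∀ i → 3 ≤ outdeg G D (suc i)
  nonroot≥3 i = ∣⇒≤ {{>-nonZero (reach⇒outdeg≥1 G D (strong (suc i) zero) (λ ()))}}
                    (nonroot⇒3∣outdeg D (proj₁ (proj₂ oriented)) (suc i) (λ ()))
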